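{- Let $G$ and $H$ be two connected non-trivial graphs, both without pendent edges, such that at least one of them is non-bipartite. Then $md(G * H) \le \min\{g_o(G), g_o(H)\}$.
   Context: The tensor product $G * H$ has vertex set $V(G)\times V(H)$, with $(u,v)$ and $(u',v')$ adjacent if and only if $uu' \in E(G)$ and $vv' \in E(H)$. A pendent edge is an edge with an endpoint of degree 1. The odd girth $g_o(G)$ of a non-bipartite graph $G$ is the length of a shortest odd cycle of $G$; for bipartite $G$, $g_o(G) = +\infty$. An edge-coloring of a graph $G$ is a map $\Gamma: E(G) \to [k]$ (adjacent edges may receive the same color). An edge-cut is monochromatic if all of its edges have the same color. An edge-coloring of $G$ is a monochromatic disconnection coloring (MD-coloring) if any two distinct vertices $u,v$ are separated by a monochromatic edge-cut (equivalently, for some color $i$, $u$ and $v$ lie in different components of the graph obtained by deleting all edges of color $i$). For a connected graph $G$, $md(G)$ is the maximum number of colors in an MD-coloring of $G$. -}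

module Defs where

open import Data.Nat using (ℕ; zero; suc; _≤_; _<_)
open import Data.Nat.Properties using ()
open import Data.Fin using (Fin; fromℕ; toℕ)
open import Data.Fin.Base using () renaming (zero to fzero; suc to fsuc)
open import Data.Bool using (Bool; true; false; _∧_; _≟_)
open import Data.List using (List; length; filter)
open import Data.List.Base using (allFin)
open import Data.Product using (Σ; ∃; ∃-syntax; _×_; _,_)
open import Data.Empty using (⊥)
open import Data.Unit using (⊤)
open import Relation.Nullary using (¬_)
open import Relation.Binary.PropositionalEquality using (_≡_; _≢_)
open import Function.Definitions using (Injective)
open import Data.Nat using (_+_; _*_)

record Graph (n : ℕ) : Set where
  field
    adj    : Fin n → Fin n → Bool
    sym    : ∀ u v → adj u v ≡ adj v u
    irrefl : ∀ v → adj v v ≡ false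
open Graph public

data WalkIn {V : Set} (E : V → V → Bool) (P : V → V → Set) : V → V → Set where
  stay : ∀ {u} → WalkIn E P u u
  step : ∀ {u w v} → E u w ≡ true → P u w → WalkIn E P w v → WalkIn E P u v

AnyEdge : {V : Set} → V → V → Set
AnyEdge _ _ = ⊤

-- An edge-colouring with k colours: a symmetric map Γ on ordered vertex pairs
-- (only its values on edges matter), using all k colours on edges.
record EdgeColoring {V : Set} (E : V → V → Bool) (k : ℕ) : Set where
  field
    col      : V → V → Fin k
    col-sym  : ∀ u v → col u v ≡ col v u
    col-surj : ∀ (i : Fin k) → ∃[ u ] ∃[ v ] (E u v ≡ true × col u v ≡ i)
open EdgeColoring public

SeparatedBy : {V : Set} {E : V → V → Bool} {k : ℕ} →
              EdgeColoring E k → Fin k → V → V → Set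
SeparatedBy {E = E} Γ i u v = ¬ WalkIn E (λ a b → col Γ a b ≢ i) u v

record MDColoring {V : Set} (E : V → V → Bool) (k : ℕ) : Set where
  field
    coloring  : EdgeColoring E k
    separates : ∀ u v → u ≢ v → ∃[ i ] SeparatedBy coloring i u v
open MDColoring public

md≤ : {V : Set} → (V → V → Bool) → ℕ → Set
md≤ E m = ∀ k → MDColoring E k → k ≤ m

Connected : ∀ {n} → Graph n → Set
Connected G = ∀ u v → WalkIn (adj G) AnyEdge u v

NonTrivial : ∀ {n} → Graph n → Set
NonTrivial {n} _ = 2 ≤ n

degree : ∀ {n} → Graph n → Fin n → ℕ
degree {n} G v = length (filter (λ w → adj G v w ≟ true) (allFin n))

NoPendentEdge : ∀ {n} → Graph n → Set
NoPendentEdge G = ∀ v → degree G v ≢ 1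

Bipartite : ∀ {n} → Graph n → Set
Bipartite {n} G = Σ (Fin n → Bool) (λ c → ∀ (u v : Fin n) → adj G u v ≡ true → c u ≢ c v)

NonBipartite : ∀ {n} → Graph n → Set
NonBipartite G = ¬ Bipartite G

-- successor modulo (suc m) on Fin (suc m)
next : ∀ {m} → Fin (suc m) → Fin (suc m)
next {zero}  _        = fzero
next {suc m} fzero    = fsuc fzero
next {suc m} (fsuc i) with next {m} i
... | fzero  = fzero
... | fsuc j = fsuc (fsuc j)

record Cycle {n} (G : Graph n) (len : ℕ) : Set where
  field
    m      : ℕ
    len≡   : len ≡ suc m
    len≥3  : 3 ≤ len
    vert   : Fin (suc m) → Fin n
    inj    : Injective _≡_ _≡_ vert
    adjc   : ∀ i → adj G (vert i) (vert (next i)) ≡ true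

data Odd : ℕ → Set where
  one  : Odd 1
  ss   : ∀ {k} → Odd k → Odd (suc (suc k))

-- g_o(G) = g : G has an odd cycle of length g and no shorter odd cycle.
-- (If G is bipartite no g satisfies this, i.e. g_o(G) = +∞.)
OddGirth : ∀ {n} → Graph n → ℕ → Set
OddGirth G g = (Odd g × Cycle G g) × (∀ l → Odd l → Cycle G l → g ≤ l)

tensorAdj : ∀ {n m} → Graph n → Graph m → (Fin n × Fin m) → (Fin n × Fin m) → Bool
tensorAdj G H (u , v) (u' , v') = adj G u u' ∧ adj H v v'

module Submission where

-- It suffices to show md(A * B) ≤ ℓ whenever A has an odd cycle
-- c₀ … c_{ℓ-1} (ℓ ≥ 3) and B is connected, non-trivial and has no pendent
-- edge; the case of a cycle in H reduces to this via G * H ≅ H * G.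
-- Pick an edge w₀w₁ of B.  As ℓ is odd, the vertices z_t = (c_{t mod ℓ},
-- w_{t mod 2}) form a closed walk Z of length 2ℓ in A * B.  Fix an
-- MD-colouring with k colours and a colour i.
--  * i occurs on Z.  Otherwise Z lies in one component of A * B minus the
--    colour-i edges.  In an MD-colouring such a component absorbs every
--    vertex with two distinct neighbours in it, and since ℓ ≥ 3 and B has
--    minimum degree 2, absorption spreads from Z to all of A * B; but the
--    two ends of a colour-i edge never lie in a common such component.
--  * i occurs at least twice on Z: otherwise the rest of Z would join the
--    ends of its colour-i edge while avoiding colour i.
-- So the k colours occupy 2k distinct positions among the 2ℓ edges of Z,
-- whence k ≤ ℓ.

open import Defs
open import Data.Nat using (ℕ; zero; suc; _+_; _∸_; _≤_; _<_; z≤n; s≤s)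
open import Data.Nat.Properties
  using (≤-refl; ≤-trans; ≤-pred; <⇒≤; n<1+n; m≤m+n; m<n⇒m<1+n; m≤n⇒m<n∨m≡n; ≤-antisym; <-trans;
         <-irrefl; <-cmp; <⇒≱; ≮⇒≥; +-mono-<; +-monoˡ-<; +-monoʳ-<; +-cancelʳ-<; +-suc; +-assoc;
         +-identityʳ; m∸n+n≡m; suc-injective; _<?_)
open import Data.Fin using (Fin; toℕ; fromℕ<; splitAt; join) renaming (zero to fzero; suc to fsuc)
open import Data.Fin.Properties
  using (toℕ-injective; toℕ<n; toℕ≤pred[n]; toℕ-fromℕ<; join-splitAt; injective⇒≤; any?)
  renaming (_≟_ to _≟ᶠ_; suc-injective to fsuc-injective)
open import Data.Bool using (Bool; true; false; not; _∧_)
open import Data.Bool.Properties using (not-involutive; ∧-comm; ∧-conicalˡ) renaming (_≟_ to _≟ᵇ_)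
open import Data.List using (length; filter; tabulate)
open import Data.List.Properties using (filter-accept; filter-reject; filter-none)
open import Data.List.Relation.Unary.All.Properties using (tabulate⁺)
open import Data.Product using (Σ; ∃-syntax; _×_; _,_; proj₁; proj₂; swap)
open import Data.Sum using (_⊎_; inj₁; inj₂; [_,_]′)
open import Data.Empty using (⊥; ⊥-elim)
open import Relation.Nullary using (¬_; yes; no)
open import Relation.Nullary.Decidable using (¬?; _×-dec_)
open import Relation.Unary using (Decidable)
open import Relation.Binary using (tri<; tri≈; tri>)
open import Relation.Binary.PropositionalEquality
  using (_≡_; _≢_; refl; trans; cong; cong₂; subst; module ≡-Reasoning) renaming (sym to ≡-sym)
open import Function using (_∘_; id)

infixr 5 _++ᵂ_

_++ᵂ_ : ∀ {V : Set} {E : V → V → Bool} {P : V → V → Set} {x y w} →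
        WalkIn E P x y → WalkIn E P y w → WalkIn E P x w
stay       ++ᵂ q = q
step e p w ++ᵂ q = step e p (w ++ᵂ q)

reverse : ∀ {V : Set} {E : V → V → Bool} {P : V → V → Set} →
          (∀ {x y} → E x y ≡ true → E y x ≡ true) → (∀ {x y} → P x y → P y x) →
          ∀ {x y} → WalkIn E P x y → WalkIn E P y x
reverse E-sym P-sym stay         = stay
reverse E-sym P-sym (step e p w) = reverse E-sym P-sym w ++ᵂ step (E-sym e) (P-sym p) stay

along : ∀ {V : Set} {E : V → V → Bool} {P : V → V → Set} (Q : V → Set) →
        (∀ {x y} → E x y ≡ true → Q x → Q y) → ∀ {x y} → WalkIn E P x y → Q x → Q y
along Q preserve stay         qx = qx
along Q preserve (step e _ w) qx = along Q preserve w (preserve e qx)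

map-walk : ∀ {V W : Set} {E : V → V → Bool} {F : W → W → Bool}
             {P : V → V → Set} {Q : W → W → Set} (φ : W → V) →
           (∀ {x y} → F x y ≡ true → E (φ x) (φ y) ≡ true) →
           (∀ {x y} → Q x y → P (φ x) (φ y)) →
           ∀ {x y} → WalkIn F Q x y → WalkIn E P (φ x) (φ y)
map-walk φ φ-edge φ-pred stay         = stay
map-walk φ φ-edge φ-pred (step e q w) = step (φ-edge e) (φ-pred q) (map-walk φ φ-edge φ-pred w)

record OccursTwice {N k : ℕ} (f : Fin N → Fin k) (i : Fin k) : Set where
  field
    first second : Fin N
    distinct     : first ≢ second
    first-hit    : f first ≡ i
    second-hit   : f second ≡ i

-- If every value of f : Fin N → Fin k is taken twice, then 2k ≤ N: picking
-- both occurrences of every value gives an injection Fin k ⊎ Fin k → Fin N.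
occurs-twice⇒≤ : ∀ {N k} (f : Fin N → Fin k) → (∀ i → OccursTwice f i) → k + k ≤ N
occurs-twice⇒≤ {N} {k} f twice =
  injective⇒≤ {f = pick ∘ splitAt k} (splitAt-injective ∘ pick-injective)
  where
  open OccursTwice

  pick : Fin k ⊎ Fin k → Fin N
  pick (inj₁ i) = first (twice i)
  pick (inj₂ i) = second (twice i)

  f-pick : ∀ x → f (pick x) ≡ [ id , id ]′ x
  f-pick (inj₁ i) = first-hit (twice i)
  f-pick (inj₂ i) = second-hit (twice i)

  pick-injective : ∀ {x y} → pick x ≡ pick y → x ≡ y
  pick-injective {x} {y} eq with trans (≡-sym (f-pick x)) (trans (cong f eq) (f-pick y))
  pick-injective {inj₁ i} {inj₁ .i} eq | refl = refl
  pick-injective {inj₂ i} {inj₂ .i} eq | refl = refl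
  pick-injective {inj₁ i} {inj₂ .i} eq | refl = ⊥-elim (distinct (twice i) eq)
  pick-injective {inj₂ i} {inj₁ .i} eq | refl = ⊥-elim (distinct (twice i) (≡-sym eq))

  splitAt-injective : ∀ {x y} → splitAt k x ≡ splitAt k y → x ≡ y
  splitAt-injective {x} {y} eq =
    trans (≡-sym (join-splitAt k k x)) (trans (cong (join k k) eq) (join-splitAt k k y))

double-≤ : ∀ {a b} → a + a ≤ b + b → a ≤ b
double-≤ aa≤bb = ≮⇒≥ λ b<a → <⇒≱ (+-mono-< b<a b<a) aa≤bb

count-unique : ∀ {A : Set} {P : A → Set} (P? : Decidable P) {n} (f : Fin n → A) (t : Fin n) →
               P (f t) → (∀ s → P (f s) → s ≡ t) → length (filter P? (tabulate f)) ≡ 1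
count-unique P? f fzero hit unique =
  trans (cong length (filter-accept P? hit))
        (cong (suc ∘ length) (filter-none P? (tabulate⁺ λ s hit′ → fsuc≢fzero (unique (fsuc s) hit′))))
  where
  fsuc≢fzero : ∀ {n} {s : Fin n} → fsuc s ≢ fzero
  fsuc≢fzero ()
count-unique P? f (fsuc t) hit unique =
  trans (cong length (filter-reject P? λ hit₀ → fzero≢fsuc (unique fzero hit₀)))
        (count-unique P? (f ∘ fsuc) t hit λ s hit′ → fsuc-injective (unique (fsuc s) hit′))
  where
  fzero≢fsuc : ∀ {n} {s : Fin n} → fzero ≢ fsuc s
  fzero≢fsuc ()

has-neighbour : ∀ {n} (G : Graph n) → Connected G → NonTrivial G → ∀ v → ∃[ t ] adj G v t ≡ true
has-neighbour {suc zero}    G connected (s≤s ()) v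
has-neighbour {suc (suc n)} G connected _ v = first-step (other v) (other≢ v) (connected v (other v))
  where
  other : Fin (suc (suc n)) → Fin (suc (suc n))
  other fzero    = fsuc fzero
  other (fsuc _) = fzero

  other≢ : ∀ u → other u ≢ u
  other≢ fzero    ()
  other≢ (fsuc _) ()

  first-step : ∀ u → u ≢ v → WalkIn (adj G) AnyEdge v u → ∃[ t ] adj G v t ≡ true
  first-step u u≢v stay                   = ⊥-elim (u≢v refl)
  first-step u u≢v (step {w = t} vt _ _) = t , vt

-- Without pendent edges every vertex then has two distinct neighbours:
-- a vertex with a unique neighbour would have degree 1.
two-neighbours : ∀ {n} (G : Graph n) → Connected G → NonTrivial G → NoPendentEdge G → ∀ v →
                 Σ (Fin n) λ t₁ → Σ (Fin n) λ t₂ → t₁ ≢ t₂ × adj G v t₁ ≡ true × adj G v t₂ ≡ true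
two-neighbours G connected nontrivial no-pendent v
  with has-neighbour G connected nontrivial v
... | t₁ , vt₁ with any? (λ t → ¬? (t ≟ᶠ t₁) ×-dec (adj G v t ≟ᵇ true))
...   | yes (t₂ , t₂≢t₁ , vt₂) = t₁ , t₂ , (λ eq → t₂≢t₁ (≡-sym eq)) , vt₁ , vt₂
...   | no none = ⊥-elim (no-pendent v (count-unique (λ t → adj G v t ≟ᵇ true) id t₁ vt₁ unique))
  where
  unique : ∀ s → adj G v s ≡ true → s ≡ t₁
  unique s vs with s ≟ᶠ t₁
  ... | yes s≡t₁ = s≡t₁
  ... | no s≢t₁  = ⊥-elim (none (s , s≢t₁ , vs))

Absorbing : {V : Set} → (V → V → Bool) → (V → Set) → Set
Absorbing E K = ∀ {x w y} → x ≢ w → K x → K w → E y x ≡ true → E y w ≡ true → K y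

module MDColouring {V : Set} {E : V → V → Bool}
  (E-sym : ∀ {x y} → E x y ≡ true → E y x ≡ true)
  (E-irrefl : ∀ {x} → E x x ≡ true → ⊥)
  {k : ℕ} (Γ : MDColoring E k) where

  colour : V → V → Fin k
  colour = col (coloring Γ)

  Avoiding : Fin k → V → V → Set
  Avoiding i = WalkIn E (λ a b → colour a b ≢ i)

  colour-flip : ∀ {a c j} → colour a c ≡ j → colour c a ≡ j
  colour-flip {a} {c} ac≡j = trans (col-sym (coloring Γ) c a) ac≡j

  reverse-avoiding : ∀ {i x y} → Avoiding i x y → Avoiding i y x
  reverse-avoiding = reverse E-sym λ xy≢i yx≡i → xy≢i (colour-flip yx≡i)

  -- The ends of an edge are separated by the colour of that very edge:
  -- any other colour leaves the edge itself in place.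
  edge-separated : ∀ {x y} → E x y ≡ true → SeparatedBy (coloring Γ) (colour x y) x y
  edge-separated {x} {y} xy with separates Γ x y (λ { refl → E-irrefl xy })
  ... | d , separated-by-d with colour x y ≟ᶠ d
  ...   | yes refl = separated-by-d
  ...   | no xy≢d  = ⊥-elim (separated-by-d (step xy xy≢d stay))

  component-proper : ∀ i b → ¬ (∀ x → Avoiding i b x)
  component-proper i b reaches-all with col-surj (coloring Γ) i
  ... | u , v , uv , refl = edge-separated uv (reverse-avoiding (reaches-all u) ++ᵂ reaches-all v)

  -- Components of a colour-deleted subgraph are absorbing: if both edges
  -- from y to x and to w had colour i, then the colour d separating x from w
  -- could be neither i (x, w share a component) nor another colour (x y w).
  absorbing : ∀ i b → Absorbing E (Avoiding i b)
  absorbing i b {x} {w} {y} x≢w bx bw yx yw with colour y x ≟ᶠ i | colour y w ≟ᶠ i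
  ... | no yx≢i | _       = bx ++ᵂ step (E-sym yx) (λ xy≡i → yx≢i (colour-flip xy≡i)) stay
  ... | yes _   | no yw≢i = bw ++ᵂ step (E-sym yw) (λ wy≡i → yw≢i (colour-flip wy≡i)) stay
  ... | yes yx≡i | yes yw≡i with separates Γ x w x≢w
  ...   | d , separated-by-d with d ≟ᶠ i
  ...     | yes refl = ⊥-elim (separated-by-d (reverse-avoiding bx ++ᵂ bw))
  ...     | no d≢i   = ⊥-elim (separated-by-d
              (step (E-sym yx) (λ xy≡d → d≢i (trans (≡-sym xy≡d) (colour-flip yx≡i)))
              (step yw (λ yw≡d → d≢i (trans (≡-sym yw≡d) yw≡i)) stay)))

-- Colours along a closed walk z₀ z₁ … of length N = suc M (indices read
-- modulo N) in a graph with an MD-colouring.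
module ClosedWalk {V : Set} {E : V → V → Bool}
  (E-sym : ∀ {x y} → E x y ≡ true → E y x ≡ true)
  (E-irrefl : ∀ {x} → E x x ≡ true → ⊥)
  {k : ℕ} (Γ : MDColoring E k)
  (M : ℕ) (z : ℕ → V)
  (z-adj : ∀ t → E (z t) (z (suc t)) ≡ true)
  (z-periodic : ∀ t → z (t + suc M) ≡ z t) where

  open MDColouring E-sym E-irrefl Γ public

  N : ℕ
  N = suc M

  edgeColour : ℕ → Fin k
  edgeColour t = colour (z t) (z (suc t))

  edgeColour-periodic : ∀ t → edgeColour (t + N) ≡ edgeColour t
  edgeColour-periodic t = cong₂ colour (z-periodic t) (z-periodic (suc t))

  sweep : ∀ i a r → (∃[ u ] u < r × edgeColour (a + u) ≡ i)
                  ⊎ (∀ u → u ≤ r → Avoiding i (z a) (z (a + u)))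
  sweep i a zero = inj₂ λ { _ z≤n → subst (Avoiding i (z a) ∘ z) (≡-sym (+-identityʳ a)) stay }
  sweep i a (suc r) with sweep i a r
  ... | inj₁ (u , u<r , hit) = inj₁ (u , m<n⇒m<1+n u<r , hit)
  ... | inj₂ reach with edgeColour (a + r) ≟ᶠ i
  ...   | yes hit = inj₁ (r , n<1+n r , hit)
  ...   | no miss = inj₂ reach′
    where
    reach′ : ∀ u → u ≤ suc r → Avoiding i (z a) (z (a + u))
    reach′ u u≤1+r with m≤n⇒m<n∨m≡n u≤1+r
    ... | inj₁ u<1+r = reach u (≤-pred u<1+r)
    ... | inj₂ refl  = subst (Avoiding i (z a) ∘ z) (≡-sym (+-suc a r))
                             (reach r ≤-refl ++ᵂ step (z-adj (a + r)) miss stay)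

  fold-window : ∀ {s p} → s < N → s < p → p < s + N →
                ∃[ q ] q < N × q ≢ s × edgeColour q ≡ edgeColour p
  fold-window {s} {p} s<N s<p p<s+N with p <? N
  ... | yes p<N = p , p<N , (λ p≡s → <-irrefl (≡-sym p≡s) s<p) , refl
  ... | no p≮N  = q , <-trans q<s s<N , (λ q≡s → <-irrefl q≡s q<s) , same-colour
    where
    q = p ∸ N
    q+N≡p : q + N ≡ p
    q+N≡p = m∸n+n≡m (≮⇒≥ p≮N)
    q<s : q < s
    q<s = +-cancelʳ-< N q s (subst (_< s + N) (≡-sym q+N≡p) p<s+N)
    same-colour : edgeColour q ≡ edgeColour p
    same-colour = trans (≡-sym (edgeColour-periodic q)) (cong edgeColour q+N≡p)

  -- A colour occurring on the closed walk occurs at a second position: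
  -- otherwise the rest of the walk joins the ends of its edge avoiding it.
  second-occurrence : ∀ {i s} → s < N → edgeColour s ≡ i →
                      ∃[ q ] q < N × q ≢ s × edgeColour q ≡ i
  second-occurrence {i} {s} s<N hit with sweep i (suc s) M
  ... | inj₁ (u , u<M , hit′) with fold-window s<N (s≤s (m≤m+n s u)) in-window
    where
    in-window : suc s + u < s + N
    in-window = subst (suc s + u <_) (≡-sym (+-suc s M)) (s≤s (+-monoʳ-< s u<M))
  ...   | q , q<N , q≢s , same = q , q<N , q≢s , trans same hit′
  second-occurrence {i} {s} s<N hit | inj₂ reach =
    ⊥-elim (subst (λ j → ¬ Avoiding j (z s) (z (suc s))) hit (edge-separated (z-adj s))
                  (reverse-avoiding back))
    where
    back : Avoiding i (z (suc s)) (z s)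
    back = subst (Avoiding i (z (suc s))) (trans (cong z (≡-sym (+-suc s M))) (z-periodic s))
                 (reach M ≤-refl)

  positionColour : Fin N → Fin k
  positionColour t = edgeColour (toℕ t)

  occurs-twice : ∀ {i s} → s < N → edgeColour s ≡ i → OccursTwice positionColour i
  occurs-twice {i} {s} s<N hit with second-occurrence s<N hit
  ... | q , q<N , q≢s , hit′ = record
    { first      = fromℕ< s<N
    ; second     = fromℕ< q<N
    ; distinct   = λ eq → q≢s (≡-sym (trans (≡-sym (toℕ-fromℕ< s<N)) (trans (cong toℕ eq) (toℕ-fromℕ< q<N))))
    ; first-hit  = trans (cong edgeColour (toℕ-fromℕ< s<N)) hit
    ; second-hit = trans (cong edgeColour (toℕ-fromℕ< q<N)) hit′
    }

  colours-on-walk : (∀ i → ∃[ s ] s < N × edgeColour s ≡ i) → k + k ≤ N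
  colours-on-walk occurs = occurs-twice⇒≤ positionColour λ i →
    let (s , s<N , hit) = occurs i in occurs-twice s<N hit

toℕ-next : ∀ {m} (j : Fin (suc m)) → toℕ j < m → toℕ (next j) ≡ suc (toℕ j)
toℕ-next {suc m} fzero    _          = refl
toℕ-next {suc m} (fsuc i) (s≤s i<m) with next {m} i | toℕ-next i i<m
... | fzero  | ()
... | fsuc j | eq = cong suc eq

next-last : ∀ {m} (j : Fin (suc m)) → toℕ j ≡ m → next j ≡ fzero
next-last {zero}  _        _  = refl
next-last {suc m} fzero    ()
next-last {suc m} (fsuc i) eq with next {m} i | next-last i (suc-injective eq)
... | fzero  | _  = refl
... | fsuc _ | ()

pos : ∀ {m} → ℕ → Fin (suc m)
pos zero    = fzero
pos (suc t) = next (pos t)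

toℕ-pos : ∀ {m} t → t ≤ m → toℕ (pos {m} t) ≡ t
toℕ-pos         zero    _   = refl
toℕ-pos {m} (suc t) t<m = trans (toℕ-next (pos t) (subst (_< m) (≡-sym ih) t<m)) (cong suc ih)
  where
  ih : toℕ (pos {m} t) ≡ t
  ih = toℕ-pos t (<⇒≤ t<m)

pos-toℕ : ∀ {m} (j : Fin (suc m)) → pos (toℕ j) ≡ j
pos-toℕ j = toℕ-injective (toℕ-pos (toℕ j) (toℕ≤pred[n] j))

pos-periodic : ∀ {m} t → pos {m} (t + suc m) ≡ pos t
pos-periodic {m} zero    = next-last (pos m) (toℕ-pos m ≤-refl)
pos-periodic     (suc t) = cong next (pos-periodic t)

prev : ∀ {m} → Fin (suc m) → Fin (suc m)
prev {m} j = pos (toℕ j + m)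

next-prev : ∀ {m} (j : Fin (suc m)) → next (prev j) ≡ j
next-prev {m} j = trans (cong pos (≡-sym (+-suc (toℕ j) m))) (trans (pos-periodic (toℕ j)) (pos-toℕ j))

2≰1 : ¬ 2 ≤ 1
2≰1 (s≤s ())

next²≢id : ∀ {m} → 2 ≤ m → (j : Fin (suc m)) → next (next j) ≢ j
next²≢id {m} 2≤m j loop with <-cmp (suc (toℕ j)) m
... | tri< 2+j≤m _ _ = <-irrefl (≡-sym (trans (≡-sym two-steps) (cong toℕ loop)))
                               (m<n⇒m<1+n (n<1+n (toℕ j)))
  where
  one-step : toℕ (next j) ≡ suc (toℕ j)
  one-step = toℕ-next j (<-trans (n<1+n (toℕ j)) 2+j≤m)
  two-steps : toℕ (next (next j)) ≡ suc (suc (toℕ j))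
  two-steps = trans (toℕ-next (next j) (subst (_< m) (≡-sym one-step) 2+j≤m)) (cong suc one-step)
... | tri≈ _ 1+j≡m _ = 2≰1 (subst (2 ≤_) (trans (≡-sym 1+j≡m) (cong (suc ∘ toℕ) j≡0)) 2≤m)
  where
  j≡0 : j ≡ fzero
  j≡0 = trans (≡-sym loop) (next-last (next j) (trans (toℕ-next j (subst (suc (toℕ j) ≤_) 1+j≡m ≤-refl)) 1+j≡m))
... | tri> _ _ m<1+j = 2≰1 (subst (2 ≤_) (trans (≡-sym j≡m) j≡1) 2≤m)
  where
  j≡m : toℕ j ≡ m
  j≡m = ≤-antisym (toℕ≤pred[n] j) (≤-pred m<1+j)
  j≡1 : toℕ j ≡ 1
  j≡1 = trans (≡-sym (cong toℕ loop))
              (trans (cong (toℕ ∘ next) (next-last j j≡m)) (toℕ-next fzero (≤-trans (s≤s z≤n) 2≤m)))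

prev≢next : ∀ {m} → 2 ≤ m → (j : Fin (suc m)) → prev j ≢ next j
prev≢next 2≤m j prev≡next = next²≢id 2≤m (prev j) (trans (cong next (next-prev j)) (≡-sym prev≡next))

parity : ℕ → Bool
parity zero    = false
parity (suc t) = not (parity t)

parity-odd : ∀ {d} → Odd d → parity d ≡ true
parity-odd one        = refl
parity-odd (ss {d} o) = trans (not-involutive (parity d)) (parity-odd o)

parity-+odd : ∀ {d} → Odd d → ∀ t → parity (t + d) ≡ not (parity t)
parity-+odd o zero    = parity-odd o
parity-+odd o (suc t) = cong not (parity-+odd o t)

false≢true : false ≢ true
false≢true ()

adj-sym : ∀ {n} (G : Graph n) {u v} → adj G u v ≡ true → adj G v u ≡ true
adj-sym G {u} {v} uv = trans (Graph.sym G v u) uv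

tensor-sym : ∀ {n m} (G : Graph n) (H : Graph m) {x y} →
             tensorAdj G H x y ≡ true → tensorAdj G H y x ≡ true
tensor-sym G H {u , v} {u′ , v′} xy = trans (cong₂ _∧_ (Graph.sym G u′ u) (Graph.sym H v′ v)) xy

tensor-irrefl : ∀ {n m} (G : Graph n) (H : Graph m) {x} → tensorAdj G H x x ≡ true → ⊥
tensor-irrefl G H {u , v} xx = false≢true (trans (≡-sym (Graph.irrefl G u)) (∧-conicalˡ _ _ xx))

tensor-edge : ∀ {n m} (G : Graph n) (H : Graph m) {u u′ v v′} →
              adj G u u′ ≡ true → adj H v v′ ≡ true → tensorAdj G H (u , v) (u′ , v′) ≡ true
tensor-edge G H uu′ vv′ = cong₂ _∧_ uu′ vv′

module DoubledCycle {nA nB} (A : Graph nA) (B : Graph nB)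
  (A-connected : Connected A) (B-connected : Connected B)
  (B-two-neighbours : ∀ b → Σ (Fin nB) λ t₁ → Σ (Fin nB) λ t₂ →
                               t₁ ≢ t₂ × adj B b t₁ ≡ true × adj B b t₂ ≡ true)
  {ℓ} (C : Cycle A ℓ) (ℓ-odd : Odd ℓ)
  (w₀ w₁ : Fin nB) (w₀w₁ : adj B w₀ w₁ ≡ true) where

  open Cycle C using (m; len≡; len≥3; vert; inj; adjc)

  E : Fin nA × Fin nB → Fin nA × Fin nB → Bool
  E = tensorAdj A B

  g : ℕ
  g = suc m

  g-odd : Odd g
  g-odd = subst Odd len≡ ℓ-odd

  2≤m : 2 ≤ m
  2≤m = ≤-pred (subst (3 ≤_) len≡ len≥3)

  layer : Bool → Fin nB
  layer false = w₀
  layer true  = w₁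

  layer-adj : ∀ b → adj B (layer b) (layer (not b)) ≡ true
  layer-adj false = w₀w₁
  layer-adj true  = adj-sym B w₀w₁

  z : ℕ → Fin nA × Fin nB
  z t = vert (pos t) , layer (parity t)

  z-adj : ∀ t → E (z t) (z (suc t)) ≡ true
  z-adj t = tensor-edge A B (adjc (pos t)) (layer-adj (parity t))

  -- g is odd, so after g steps the walk is in the other layer, after 2g back.
  z-periodic : ∀ t → z (t + (g + g)) ≡ z t
  z-periodic t = cong₂ _,_ (cong vert same-index) (cong layer same-parity)
    where
    open ≡-Reasoning
    same-index : pos (t + (g + g)) ≡ pos t
    same-index = begin
      pos (t + (g + g))  ≡⟨ cong pos (≡-sym (+-assoc t g g)) ⟩
      pos (t + g + g)    ≡⟨ pos-periodic (t + g) ⟩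
      pos (t + g)        ≡⟨ pos-periodic t ⟩
      pos t              ∎
    same-parity : parity (t + (g + g)) ≡ parity t
    same-parity = begin
      parity (t + (g + g))      ≡⟨ cong parity (≡-sym (+-assoc t g g)) ⟩
      parity (t + g + g)        ≡⟨ parity-+odd g-odd (t + g) ⟩
      not (parity (t + g))      ≡⟨ cong not (parity-+odd g-odd t) ⟩
      not (not (parity t))      ≡⟨ not-involutive (parity t) ⟩
      parity t                  ∎

  z-covers-layer₀ : ∀ j → ∃[ t ] t < g + g × z t ≡ (vert j , w₀)
  z-covers-layer₀ j with parity (toℕ j) in even
  ... | false = toℕ j , ≤-trans (toℕ<n j) (m≤m+n g g) , cong₂ _,_ (cong vert (pos-toℕ j)) (cong layer even)
  ... | true  = toℕ j + g , +-monoˡ-< g (toℕ<n j) ,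
                cong₂ _,_ (cong vert (trans (pos-periodic (toℕ j)) (pos-toℕ j)))
                          (cong layer (trans (parity-+odd g-odd (toℕ j)) (cong not even)))

  -- An absorbing set containing Z is everything: it spreads from the
  -- cycle-copy in one layer to the neighbouring layers (each (c_j, b′) has
  -- the distinct neighbours (c_{j-1}, b), (c_{j+1}, b)), hence to the column
  -- of c₀, and then from column to column (via two neighbours in B).
  absorbs-everything : ∀ K → Absorbing E K → (∀ t → t < g + g → K (z t)) → ∀ x → K x
  absorbs-everything K K-absorbing K-on-Z (a , b) =
    along Column column-step (A-connected (vert fzero) a) column₀ b
    where
    Layer : Fin nB → Set
    Layer b = ∀ j → K (vert j , b)

    layer₀ : Layer w₀
    layer₀ j with z-covers-layer₀ j
    ... | t , t<2g , zt≡ = subst K zt≡ (K-on-Z t t<2g)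

    layer-step : ∀ {b b′} → adj B b b′ ≡ true → Layer b → Layer b′
    layer-step {b} {b′} bb′ K-b j =
      K-absorbing (λ eq → prev≢next 2≤m j (inj (cong proj₁ eq))) (K-b (prev j)) (K-b (next j))
        (tensor-edge A B (adj-sym A prev-adj) (adj-sym B bb′))
        (tensor-edge A B (adjc j) (adj-sym B bb′))
      where
      prev-adj : adj A (vert (prev j)) (vert j) ≡ true
      prev-adj = subst (λ i → adj A (vert (prev j)) (vert i) ≡ true) (next-prev j) (adjc (prev j))

    Column : Fin nA → Set
    Column a = ∀ b → K (a , b)

    column₀ : Column (vert fzero)
    column₀ b = along Layer layer-step (B-connected w₀ b) layer₀ fzero

    column-step : ∀ {a a′} → adj A a a′ ≡ true → Column a → Column a′
    column-step aa′ K-a b with B-two-neighbours b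
    ... | t₁ , t₂ , t₁≢t₂ , bt₁ , bt₂ =
      K-absorbing (λ eq → t₁≢t₂ (cong proj₂ eq)) (K-a t₁) (K-a t₂)
        (tensor-edge A B (adj-sym A aa′) bt₁) (tensor-edge A B (adj-sym A aa′) bt₂)

  -- Every MD-colouring of A * B uses at most g colours: each colour occurs
  -- on Z, for otherwise its colour-deleted component of z₀ would contain Z,
  -- hence (being absorbing) every vertex.
  colour-bound : ∀ {k} → MDColoring E k → k ≤ g
  colour-bound {k} Γ = double-≤ (colours-on-walk every-colour-occurs)
    where
    open ClosedWalk (tensor-sym A B) (tensor-irrefl A B) Γ (m + g) z z-adj z-periodic

    every-colour-occurs : ∀ i → ∃[ s ] s < N × edgeColour s ≡ i
    every-colour-occurs i with sweep i 0 (m + g)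
    ... | inj₁ (u , u<M , hit) = u , m<n⇒m<1+n u<M , hit
    ... | inj₂ reach = ⊥-elim (component-proper i (z 0)
            (absorbs-everything (Avoiding i (z 0)) (absorbing i (z 0)) λ t t<N → reach t (≤-pred t<N)))

md≤-tensor : ∀ {nA nB} (A : Graph nA) (B : Graph nB) →
             Connected A → Connected B → NonTrivial B → NoPendentEdge B →
             ∀ {ℓ} → Cycle A ℓ → Odd ℓ → md≤ (tensorAdj A B) ℓ
md≤-tensor A B A-connected B-connected B-nontrivial B-no-pendent C ℓ-odd k Γ =
  subst (k ≤_) (≡-sym (Cycle.len≡ C)) (colour-bound Γ)
  where
  w₀ : Fin _
  w₀ = fromℕ< B-nontrivial
  open DoubledCycle A B A-connected B-connected
         (two-neighbours B B-connected B-nontrivial B-no-pendent) C ℓ-odd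
         w₀ (proj₁ (has-neighbour B B-connected B-nontrivial w₀))
         (proj₂ (has-neighbour B B-connected B-nontrivial w₀))

md≤-iso : ∀ {V W : Set} {E : V → V → Bool} {F : W → W → Bool} (φ : W → V) (ψ : V → W) →
          (∀ v → φ (ψ v) ≡ v) → (∀ w → ψ (φ w) ≡ w) → (∀ x y → F x y ≡ E (φ x) (φ y)) →
          ∀ {ℓ} → md≤ F ℓ → md≤ E ℓ
md≤-iso {E = E} {F} φ ψ φψ ψφ F≡E bound k Γ = bound k Γ′
  where
  κ : EdgeColoring E k
  κ = coloring Γ

  surjective : ∀ i → ∃[ x ] ∃[ y ] (F x y ≡ true × col κ (φ x) (φ y) ≡ i)
  surjective i with col-surj κ i
  ... | u , v , uv , uv≡i = ψ u , ψ v , trans (F≡E (ψ u) (ψ v)) (trans (cong₂ E (φψ u) (φψ v)) uv)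
                                     , trans (cong₂ (col κ) (φψ u) (φψ v)) uv≡i

  φ-injective : ∀ {x y} → φ x ≡ φ y → x ≡ y
  φ-injective {x} {y} eq = trans (≡-sym (ψφ x)) (trans (cong ψ eq) (ψφ y))

  Γ′ : MDColoring F k
  Γ′ = record
    { coloring  = record { col = λ x y → col κ (φ x) (φ y)
                         ; col-sym = λ x y → col-sym κ (φ x) (φ y)
                         ; col-surj = surjective }
    ; separates = λ x y x≢y →
        let (i , separated) = separates Γ (φ x) (φ y) (x≢y ∘ φ-injective)
        in i , λ walk → separated (map-walk φ (λ {a} {b} ab → trans (≡-sym (F≡E a b)) ab) id walk)
    }

md≤-swap : ∀ {n m} (G : Graph n) (H : Graph m) {ℓ} → md≤ (tensorAdj H G) ℓ → md≤ (tensorAdj G H) ℓ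
md≤-swap G H = md≤-iso swap swap (λ _ → refl) (λ _ → refl)
  λ { (v , u) (v′ , u′) → ∧-comm (adj H v v′) (adj G u u′) }

corollary4p10 : ∀ {n m} (G : Graph n) (H : Graph m) →
    Connected G → Connected H → NonTrivial G → NonTrivial H →
    NoPendentEdge G → NoPendentEdge H →
    NonBipartite G ⊎ NonBipartite H →
    (∀ (g : ℕ) → OddGirth G g ⊎ OddGirth H g → md≤ (tensorAdj G H) g)
corollary4p10 G H G-connected H-connected G-nontrivial H-nontrivial G-no-pendent H-no-pendent _ g
  (inj₁ ((g-odd , C) , _)) = md≤-tensor G H G-connected H-connected H-nontrivial H-no-pendent C g-odd
corollary4p10 G H G-connected H-connected G-nontrivial H-nontrivial G-no-pendent H-no-pendent _ g
  (inj₂ ((g-odd , C) , _)) =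
  md≤-swap G H (md≤-tensor H G H-connected G-connected G-nontrivial G-no-pendent C g-odd)
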